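{- Let $N\ge1$ be an odd integer with $N=N_0N_1$, $N_0,N_1$ positive and $\gcd(N_0,N_1)=1$. Let $p$ be an odd prime with $p\nmid N$ and let $\Delta$ be a discriminant with $p\mid\Delta$ and $p^2\nmid\Delta$. Then both maps $\mathrm{id}:[aNp,b,c]\mapsto[(ap)N,b,c]$ and $\tau:[aNp,b,c]\mapsto[aN,b,cp]$ induce bijections \[ \mathcal L_{Np}(N_0^2\Delta)/\Gamma_0(Np)\ \longrightarrow\ \mathcal L_N(N_0^2\Delta)/\Gamma_0(N). \]
   Context: $[a,b,c]$ denotes the integral binary quadratic form $aX^2+bXY+cY^2$, with discriminant $b^2-4ac$; $\gamma\in\Gamma_0(M)$ acts by $(Q\circ\gamma)(X,Y)=Q((X,Y){}^t\gamma)$. For an integer $M\ge1$ and an integer $D$, $\mathcal L_M(D)$ is the set of integral binary quadratic forms $[a,b,c]$ with $b^2-4ac=D$, $M\mid a$ and $\gcd(N_0,c)=1$; it is stable under $\Gamma_0(M)$. A discriminant is an integer congruent to $0$ or $1$ modulo $4$. -}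

module Defs where

open import Data.Nat as ℕ using (ℕ; NonZero)
open import Data.Nat.Primality using (Prime; prime)
open import Data.Integer using (ℤ; +_; _+_; _-_; _*_; _/ℕ_)
open import Data.Integer.Divisibility using (_∣_)
open import Data.Integer.Coprimality using (Coprime)
open import Data.Product using (Σ; ∃; _×_; _,_)
open import Data.Sum using (_⊎_)
open import Relation.Binary.PropositionalEquality using (_≡_)

-- [a,b,c] = a X^2 + b X Y + c Y^2
record Form : Set where
  constructor [_,_,_]
  field
    a b c : ℤ
open Form public

disc : Form → ℤ
disc Q = b Q * b Q - (+ 4) * (a Q * c Q)

IsDiscriminant : ℤ → Set
IsDiscriminant D = ∃ λ k → (D ≡ (+ 4) * k) ⊎ (D ≡ (+ 4) * k + + 1)

record Mat : Set where
  constructor mat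
  field
    α β γ δ : ℤ
open Mat public

InΓ₀ : ℕ → Mat → Set
InΓ₀ M g = (α g * δ g - β g * γ g ≡ + 1) × (+ M ∣ γ g)

-- (Q ∘ g)(X,Y) = Q((X,Y) gᵗ) = Q(αX + βY, γX + δY)
act : Form → Mat → Form
act [ a , b , c ] (mat α β γ δ) =
  [ a * α * α + b * α * γ + c * γ * γ
  , (+ 2) * a * α * β + b * (α * δ + β * γ) + (+ 2) * c * γ * δ
  , a * β * β + b * β * δ + c * δ * δ ]

_≈[_]_ : Form → ℕ → Form → Set
Q ≈[ M ] Q' = Σ Mat λ g → InΓ₀ M g × (act Q g ≡ Q')

InL : (N₀ M : ℕ) (D : ℤ) → Form → Set
InL N₀ M D Q = (disc Q ≡ D) × (+ M ∣ a Q) × Coprime (+ N₀) (c Q)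

InducesBijection : (N₀ M M' : ℕ) (D : ℤ) → (Form → Form) → Set
InducesBijection N₀ M M' D f =
    (∀ Q → InL N₀ M D Q → InL N₀ M' D (f Q))
  × (∀ Q Q' → InL N₀ M D Q → InL N₀ M D Q' → Q ≈[ M ] Q' → f Q ≈[ M' ] f Q')
  × (∀ Q Q' → InL N₀ M D Q → InL N₀ M D Q' → f Q ≈[ M' ] f Q' → Q ≈[ M ] Q')
  × (∀ R → InL N₀ M' D R → ∃ λ Q → InL N₀ M D Q × (f Q ≈[ M' ] R))

idMap : Form → Form
idMap Q = Q

τ : (p : ℕ) → Prime p → Form → Form
τ p (prime {{nt}} _) [ a , b , c ] =
  [ _/ℕ_ a p {{ℕ.nonTrivial⇒nonZero p {{nt}}}} , b , c * + p ]

-- Write D = N₀²Δ. Since p ∥ D, a form [a, b, c] of discriminant D with p ∣ a has p ∣ b and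
-- p ∤ c, and every Γ₀(N)-class in 𝓛_N(D) contains forms with p ∣ a and forms with p ∣ c
-- (move by a translation to get p ∣ b, hence p ∣ c, then by a matrix of Γ₀(N) with first
-- column (p, N)).  So id is surjective on classes, and it is injective because a g ∈ Γ₀(N)
-- between two forms with p ∣ a has p ∣ γ g, i.e. g ∈ Γ₀(Np).  The map τ, [kp, b, c] ↦ [k, b, cp],
-- is conjugation by diag(p, 1): it turns (x y ; zp w) ∈ Γ₀(Np) into (x py ; z w) ∈ Γ₀(N),
-- and conversely every g ∈ Γ₀(N) between images of τ has p ∣ β g by the same argument.

module Submission where

open import Defs
open import Data.Nat using (ℕ; _*_; _≤_; _^_)
open import Data.Nat.Divisibility using (_∣_)
open import Data.Nat.Coprimality using (Coprime)
open import Data.Nat.Primality using (Prime)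
open import Data.Integer using (ℤ; +_)
import Data.Integer as ℤ
import Data.Integer.Divisibility as ℤ
open import Data.Product using (_×_)
open import Relation.Nullary using (¬_)
open import Relation.Binary.PropositionalEquality using (_≡_)

open import Data.Nat as ℕ using (suc; NonZero)
import Data.Nat.Properties as ℕ
import Data.Nat.DivMod as ℕ
import Data.Nat.Divisibility as ℕ
import Data.Nat.Coprimality as Coprime
open import Data.Nat.GCD using (module Bézout)
open import Data.Nat.LCM using (lcm; lcm-least; gcd*lcm)
open import Data.Nat.Primality using (prime⇒irreducible; prime⇒nonZero; irreducible[2]; ¬prime[1])
open import Data.Integer using (-[1+_]; _+_; _-_; -_; _/ℕ_; ∣_∣) renaming (_*_ to _·_)
open import Data.Integer.Properties using (pos-*; abs-*; neg-distribˡ-*)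
import Data.Integer.Properties as ℤ
open import Data.Integer.Divisibility.Signed as Signed
  using (divides; ∣ᵤ⇒∣; ∣⇒∣ᵤ) renaming (_∣_ to _∣ₛ_)
open import Data.Integer.Tactic.RingSolver using (solve; solve-∀)
open import Data.List using ([]; _∷_)
open import Data.Product using (∃; ∃₂; _,_; proj₁)
open import Data.Sum using (inj₁; inj₂)
open import Data.Empty using (⊥-elim)
import Data.Integer.Coprimality as ℤCoprime
open import Relation.Nullary using (yes; no)
open import Function using (case_of_)
open import Relation.Binary.PropositionalEquality
  using (refl; sym; trans; cong; cong₂; subst; subst₂; module ≡-Reasoning)

i*n/ℕn≡i : ∀ i n .{{_ : NonZero n}} → (i · + n) /ℕ n ≡ i
i*n/ℕn≡i (+ m) n = trans (cong (_/ℕ n) (sym (pos-* m n))) (cong +_ (ℕ.m*n/n≡m m n))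
i*n/ℕn≡i -[1+ m ] n@(suc _) with suc m ℕ.* n ℕ.% n | ℕ.m*n%n≡0 (suc m) n
... | .0 | refl = cong (λ k → - (+ k)) (ℕ.m*n/n≡m (suc m) n)

pos-^2 : ∀ n → + (n ^ 2) ≡ + n · + n
pos-^2 n = trans (cong (λ k → + (n * k)) (ℕ.*-identityʳ n)) (pos-* n n)

prime∤⇒coprime : ∀ {p n} → Prime p → ¬ p ∣ n → Coprime p n
prime∤⇒coprime pr p∤n (d∣p , d∣n) with prime⇒irreducible pr d∣p
... | inj₁ d≡1 = d≡1
... | inj₂ refl = ⊥-elim (p∤n d∣n)

prime∤i⇒∣i*j⇒∣j : ∀ {p} → Prime p → ∀ {i j} → ¬ + p ∣ₛ i → + p ∣ₛ i · j → + p ∣ₛ j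
prime∤i⇒∣i*j⇒∣j {p} pr {i} {j} p∤i p∣ij = ∣ᵤ⇒∣ (ℤCoprime.coprime-divisor (+ p) i j
  (prime∤⇒coprime pr (λ p∣i → p∤i (∣ᵤ⇒∣ {+ p} {i} p∣i))) (∣⇒∣ᵤ p∣ij))

prime∣i*i⇒∣i : ∀ {p} → Prime p → ∀ i → + p ∣ₛ i · i → + p ∣ₛ i
prime∣i*i⇒∣i {p} pr i p∣ii with + p Signed.∣? i
... | yes p∣i = p∣i
... | no p∤i = prime∤i⇒∣i*j⇒∣j pr p∤i p∣ii

1+ab≡cd⇒cd-ab≡1 : ∀ a b c d → 1 ℕ.+ a ℕ.* b ≡ c ℕ.* d → + c · + d - + a · + b ≡ + 1
1+ab≡cd⇒cd-ab≡1 a b c d eq = 1+j≡i⇒i-j≡1 (begin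
  + 1 + + a · + b   ≡⟨ cong (_+_ (+ 1)) (pos-* a b) ⟨
  + (1 ℕ.+ a ℕ.* b) ≡⟨ cong +_ eq ⟩
  + (c ℕ.* d)       ≡⟨ pos-* c d ⟩
  + c · + d         ∎)
  where
  open ≡-Reasoning
  1+j≡i⇒i-j≡1 : ∀ {i j} → + 1 + j ≡ i → i - j ≡ + 1
  1+j≡i⇒i-j≡1 {j = j} refl = solve (j ∷ [])

bézoutℕ : ∀ {m n} → Coprime m n → ∃₂ λ u v → u · + m + v · + n ≡ + 1
bézoutℕ {m} {n} m⊥n with Coprime.coprime-Bézout m⊥n
... | Bézout.Identity.+- x y eq = + x , - + y ,
  trans (cong (_+_ (+ x · + m)) (sym (neg-distribˡ-* (+ y) (+ n)))) (1+ab≡cd⇒cd-ab≡1 y n x m eq)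
... | Bézout.Identity.-+ x y eq = - + x , + y ,
  trans (cong (_+ + y · + n) (sym (neg-distribˡ-* (+ x) (+ m))))
        (trans (ℤ.+-comm (- (+ x · + m)) (+ y · + n)) (1+ab≡cd⇒cd-ab≡1 x m y n eq))

-- Results built on Bézout are taken apart with case rather than with: with-abstraction
-- normalises its scrutinee, which would unfold the extended Euclidean algorithm.
bézoutℤ : ∀ i n → Coprime ∣ i ∣ n → ∃₂ λ u v → u · i + v · + n ≡ + 1
bézoutℤ (+ m) n m⊥n = bézoutℕ m⊥n
bézoutℤ -[1+ m ] n m⊥n = case bézoutℕ m⊥n of λ (u , v , eq) →
  - u , v , trans (cong (_+ v · + n) (neg*neg u (+ suc m))) eq
  where
  neg*neg : ∀ i j → - i · - j ≡ i · j
  neg*neg = solve-∀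

coprime-∣ˡ : ∀ {d m n} → d ∣ m → Coprime m n → Coprime d n
coprime-∣ˡ d∣m m⊥n (e∣d , e∣n) = m⊥n (ℕ.∣-trans e∣d d∣m , e∣n)

coprime-∣ʳ : ∀ {d m n} → d ∣ n → Coprime m n → Coprime m d
coprime-∣ʳ d∣n m⊥n (e∣m , e∣d) = m⊥n (e∣m , ℕ.∣-trans e∣d d∣n)

coprime-* : ∀ {m i j} → Coprime m i → Coprime m j → Coprime m (i * j)
coprime-* m⊥i m⊥j (d∣m , d∣ij) = m⊥j (d∣m , Coprime.coprime-divisor (coprime-∣ˡ d∣m m⊥i) d∣ij)

coprime-^2 : ∀ {m n} → Coprime m n → Coprime m (n ^ 2)
coprime-^2 {m} m⊥n = coprime-* m⊥n (coprime-* m⊥n (Coprime.sym (Coprime.1-coprimeTo m)))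

coprime-∣⇒*∣ : ∀ {m n k} → Coprime m n → m ∣ k → n ∣ k → m * n ∣ k
coprime-∣⇒*∣ {m} {n} m⊥n m∣k n∣k = subst (_∣ _) lcm≡mn (lcm-least m∣k n∣k)
  where
  lcm≡mn : lcm m n ≡ m * n
  lcm≡mn = trans (sym (ℕ.*-identityˡ (lcm m n)))
                 (trans (cong (_* lcm m n) (sym (Coprime.coprime⇒gcd≡1 m⊥n))) (gcd*lcm m n))

-- By definition of act, a (act Q g) = value Q (α g) (γ g), b (act Q g) = polar Q (α g) (γ g) (β g) (δ g)
-- and c (act Q g) = value Q (β g) (δ g).
form-cong : ∀ {a b c a' b' c'} → a ≡ a' → b ≡ b' → c ≡ c' → [ a , b , c ] ≡ [ a' , b' , c' ]
form-cong refl refl refl = refl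

value : Form → ℤ → ℤ → ℤ
value Q x y = a Q · x · x + b Q · x · y + c Q · y · y

polar : Form → ℤ → ℤ → ℤ → ℤ → ℤ
polar Q x z y w = (+ 2) · a Q · x · y + b Q · (x · w + y · z) + (+ 2) · c Q · z · w

det : Mat → ℤ
det g = α g · δ g - β g · γ g

I₂ : Mat
I₂ = mat (+ 1) (+ 0) (+ 0) (+ 1)

_⊗_ : Mat → Mat → Mat
mat x y z w ⊗ mat x' y' z' w' =
  mat (x · x' + y · z') (x · y' + y · w') (z · x' + w · z') (z · y' + w · w')

adj : Mat → Mat
adj (mat x y z w) = mat w (- y) (- z) x

det-⊗ : ∀ g h → det (g ⊗ h) ≡ det g · det h
det-⊗ (mat x y z w) (mat x' y' z' w') = poly x y z w x' y' z' w'
  where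
  poly : ∀ x y z w x' y' z' w' →
    (x · x' + y · z') · (z · y' + w · w') - (x · y' + y · w') · (z · x' + w · z')
      ≡ (x · w - y · z) · (x' · w' - y' · z')
  poly = solve-∀

det-adj : ∀ g → det (adj g) ≡ det g
det-adj (mat x y z w) = poly x y z w
  where
  poly : ∀ x y z w → w · x - (- y) · (- z) ≡ x · w - y · z
  poly = solve-∀

⊗-adj : ∀ g → det g ≡ + 1 → g ⊗ adj g ≡ I₂
⊗-adj (mat x y z w) det≡1 =
  mat-cong (trans (poly₁ x y z w) det≡1) (poly₂ x y) (poly₃ z w) (trans (poly₄ x y z w) det≡1)
  where
  mat-cong : ∀ {x y z w x' y' z' w'} → x ≡ x' → y ≡ y' → z ≡ z' → w ≡ w' →
             mat x y z w ≡ mat x' y' z' w'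
  mat-cong refl refl refl refl = refl
  poly₁ : ∀ x y z w → x · w + y · (- z) ≡ x · w - y · z
  poly₁ = solve-∀
  poly₂ : ∀ x y → x · (- y) + y · x ≡ + 0
  poly₂ = solve-∀
  poly₃ : ∀ z w → z · w + w · (- z) ≡ + 0
  poly₃ = solve-∀
  poly₄ : ∀ x y z w → z · (- y) + w · x ≡ x · w - y · z
  poly₄ = solve-∀

act-I₂ : ∀ Q → act Q I₂ ≡ Q
act-I₂ [ a , b , c ] = form-cong (polyᵃ a b c) (polyᵇ a b c) (polyᶜ a b c)
  where
  polyᵃ : ∀ a b c → a · + 1 · + 1 + b · + 1 · + 0 + c · + 0 · + 0 ≡ a
  polyᵃ = solve-∀
  polyᵇ : ∀ a b c → (+ 2) · a · + 1 · + 0 + b · (+ 1 · + 1 + + 0 · + 0) + (+ 2) · c · + 0 · + 1 ≡ b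
  polyᵇ = solve-∀
  polyᶜ : ∀ a b c → a · + 0 · + 0 + b · + 0 · + 1 + c · + 1 · + 1 ≡ c
  polyᶜ = solve-∀

value-act : ∀ Q g u v → value (act Q g) u v ≡ value Q (α g · u + β g · v) (γ g · u + δ g · v)
value-act [ a , b , c ] (mat x y z w) u v = poly a b c x y z w u v
  where
  poly : ∀ a b c x y z w u v →
    (a · x · x + b · x · z + c · z · z) · u · u
      + ((+ 2) · a · x · y + b · (x · w + y · z) + (+ 2) · c · z · w) · u · v
      + (a · y · y + b · y · w + c · w · w) · v · v
    ≡ a · (x · u + y · v) · (x · u + y · v) + b · (x · u + y · v) · (z · u + w · v)
      + c · (z · u + w · v) · (z · u + w · v)
  poly = solve-∀

polar-act : ∀ Q g u v u' v' → polar (act Q g) u v u' v'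
  ≡ polar Q (α g · u + β g · v) (γ g · u + δ g · v) (α g · u' + β g · v') (γ g · u' + δ g · v')
polar-act [ a , b , c ] (mat x y z w) u v u' v' = poly a b c x y z w u v u' v'
  where
  poly : ∀ a b c x y z w u v u' v' →
    (+ 2) · (a · x · x + b · x · z + c · z · z) · u · u'
      + ((+ 2) · a · x · y + b · (x · w + y · z) + (+ 2) · c · z · w) · (u · v' + u' · v)
      + (+ 2) · (a · y · y + b · y · w + c · w · w) · v · v'
    ≡ (+ 2) · a · (x · u + y · v) · (x · u' + y · v')
      + b · ((x · u + y · v) · (z · u' + w · v') + (x · u' + y · v') · (z · u + w · v))
      + (+ 2) · c · (z · u + w · v) · (z · u' + w · v')
  poly = solve-∀

act-⊗ : ∀ Q g h → act (act Q g) h ≡ act Q (g ⊗ h)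
act-⊗ Q g h = form-cong (value-act Q g (α h) (γ h)) (polar-act Q g (α h) (γ h) (β h) (δ h))
                        (value-act Q g (β h) (δ h))

disc-act : ∀ Q g → disc (act Q g) ≡ det g · det g · disc Q
disc-act [ a , b , c ] (mat x y z w) = poly a b c x y z w
  where
  poly : ∀ a b c x y z w →
    let a' = a · x · x + b · x · z + c · z · z
        b' = (+ 2) · a · x · y + b · (x · w + y · z) + (+ 2) · c · z · w
        c' = a · y · y + b · y · w + c · w · w
    in b' · b' - (+ 4) · (a' · c') ≡ (x · w - y · z) · (x · w - y · z) · (b · b - (+ 4) · (a · c))
  poly = solve-∀

Γ₀-intro : ∀ {M} g → det g ≡ + 1 → + M ∣ₛ γ g → InΓ₀ M g
Γ₀-intro {M} g det-g M∣γ = det-g , ∣⇒∣ᵤ {+ M} {γ g} M∣γ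

Γ₀-∣γ : ∀ {M} g → InΓ₀ M g → + M ∣ₛ γ g
Γ₀-∣γ {M} g (_ , M∣γ) = ∣ᵤ⇒∣ {+ M} {γ g} M∣γ

Γ₀-I₂ : ∀ M → InΓ₀ M I₂
Γ₀-I₂ M = Γ₀-intro I₂ refl (divides (+ 0) refl)

Γ₀-⊗ : ∀ {M} g h → InΓ₀ M g → InΓ₀ M h → InΓ₀ M (g ⊗ h)
Γ₀-⊗ g h g∈Γ₀@(det-g , _) h∈Γ₀@(det-h , _) =
  Γ₀-intro (g ⊗ h) (trans (det-⊗ g h) (cong₂ _·_ det-g det-h))
    (Signed.∣m∣n⇒∣m+n (Signed.∣m⇒∣m*n (α h) (Γ₀-∣γ g g∈Γ₀))
                      (Signed.∣n⇒∣m*n (δ g) (Γ₀-∣γ h h∈Γ₀)))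

Γ₀-adj : ∀ {M} g → InΓ₀ M g → InΓ₀ M (adj g)
Γ₀-adj g g∈Γ₀@(det-g , _) =
  Γ₀-intro (adj g) (trans (det-adj g) det-g) (Signed.∣m⇒∣-m (Γ₀-∣γ g g∈Γ₀))

Γ₀-mono : ∀ {M M'} g → M ∣ M' → InΓ₀ M' g → InΓ₀ M g
Γ₀-mono g M∣M' (det-g , M'∣γ) = det-g , ℕ.∣-trans M∣M' M'∣γ

act-adj : ∀ Q g → det g ≡ + 1 → act (act Q g) (adj g) ≡ Q
act-adj Q g det-g = trans (act-⊗ Q g (adj g)) (trans (cong (act Q) (⊗-adj g det-g)) (act-I₂ Q))

disc-Γ₀ : ∀ Q g → det g ≡ + 1 → disc (act Q g) ≡ disc Q
disc-Γ₀ Q g det-g =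
  trans (disc-act Q g) (trans (cong (λ t → t · t · disc Q) det-g) (ℤ.*-identityˡ (disc Q)))

≈-refl : ∀ {M Q} → Q ≈[ M ] Q
≈-refl {M} {Q} = I₂ , Γ₀-I₂ M , act-I₂ Q

≈-sym : ∀ {M Q Q'} → Q ≈[ M ] Q' → Q' ≈[ M ] Q
≈-sym {Q = Q} (g , g∈Γ₀ , refl) = adj g , Γ₀-adj g g∈Γ₀ , act-adj Q g (proj₁ g∈Γ₀)

≈-trans : ∀ {M Q Q' Q''} → Q ≈[ M ] Q' → Q' ≈[ M ] Q'' → Q ≈[ M ] Q''
≈-trans {Q = Q} (g , g∈Γ₀ , refl) (h , h∈Γ₀ , refl) =
  g ⊗ h , Γ₀-⊗ g h g∈Γ₀ h∈Γ₀ , sym (act-⊗ Q g h)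

≈-mono : ∀ {M M' Q Q'} → M ∣ M' → Q ≈[ M' ] Q' → Q ≈[ M ] Q'
≈-mono M∣M' (g , g∈Γ₀ , eq) = g , Γ₀-mono g M∣M' g∈Γ₀ , eq

≈-disc : ∀ {M Q Q'} → Q ≈[ M ] Q' → disc Q' ≡ disc Q
≈-disc {Q = Q} (g , (det-g , _) , refl) = disc-Γ₀ Q g det-g

∣a∧∣y⇒∣value : ∀ {d} Q x y → d ∣ₛ a Q → d ∣ₛ y → d ∣ₛ value Q x y
∣a∧∣y⇒∣value Q x y d∣a d∣y = Signed.∣m∣n⇒∣m+n
  (Signed.∣m∣n⇒∣m+n (Signed.∣m⇒∣m*n x (Signed.∣m⇒∣m*n x d∣a)) (Signed.∣n⇒∣m*n (b Q · x) d∣y))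
  (Signed.∣m⇒∣m*n y (Signed.∣n⇒∣m*n (c Q) d∣y))

∣x∧∣b∧∣c⇒∣value : ∀ {d} Q x y → d ∣ₛ x → d ∣ₛ b Q → d ∣ₛ c Q → d ∣ₛ value Q x y
∣x∧∣b∧∣c⇒∣value Q x y d∣x d∣b d∣c = Signed.∣m∣n⇒∣m+n
  (Signed.∣m∣n⇒∣m+n (Signed.∣m⇒∣m*n x (Signed.∣n⇒∣m*n (a Q) d∣x))
                    (Signed.∣m⇒∣m*n y (Signed.∣m⇒∣m*n x d∣b)))
  (Signed.∣m⇒∣m*n y (Signed.∣m⇒∣m*n y d∣c))

∣a∧∣c∧²∣disc⇒∣value² : ∀ {d} Q x y → d ∣ₛ a Q → d ∣ₛ c Q → d · d ∣ₛ disc Q →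
                        d ∣ₛ value Q x y · value Q x y
∣a∧∣c∧²∣disc⇒∣value² {d} [ .(u · d) , b , .(v · d) ] x y
  (divides u refl) (divides v refl) (divides e disc≡) =
  let s = u · x · x + v · y · y
      r = d · s · s + (+ 2) · s · b · x · y
      ac = (u · d) · (v · d)
  in divides (r + (e · d + (+ 4) · u · v · d) · x · x · y · y) (begin
    ((u · d) · x · x + b · x · y + (v · d) · y · y) · ((u · d) · x · x + b · x · y + (v · d) · y · y)
      ≡⟨ solve (u ∷ v ∷ b ∷ d ∷ x ∷ y ∷ []) ⟩
    d · r + (b · b - (+ 4) · ac + (+ 4) · ac) · (x · x · y · y)
      ≡⟨ cong (λ t → d · r + (t + (+ 4) · ac) · (x · x · y · y)) disc≡ ⟩
    d · r + (e · (d · d) + (+ 4) · ac) · (x · x · y · y)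
      ≡⟨ solve (u ∷ v ∷ b ∷ d ∷ e ∷ x ∷ y ∷ []) ⟩
    (r + (e · d + (+ 4) · u · v · d) · x · x · y · y) · d ∎)
  where open ≡-Reasoning

≈-preserves-L : ∀ {N₀ M D Q Q'} → N₀ ∣ M → + (N₀ ^ 2) ∣ₛ D → Q ≈[ M ] Q' →
                InL N₀ M D Q → InL N₀ M D Q'
≈-preserves-L {N₀} {M} {D} {Q} N₀∣M N₀²∣D (g , g∈Γ₀@(det-g , _) , refl) (disc≡D , M∣a , N₀⊥c) =
  disc'≡D , ∣⇒∣ᵤ {+ M} {a Q'} M∣a' , N₀⊥c'
  where
  Q' = act Q g
  disc'≡D : disc Q' ≡ D
  disc'≡D = trans (disc-Γ₀ Q g det-g) disc≡D
  M∣a' : + M ∣ₛ a Q'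
  M∣a' = ∣a∧∣y⇒∣value Q (α g) (γ g) (∣ᵤ⇒∣ {+ M} {a Q} M∣a) (Γ₀-∣γ g g∈Γ₀)
  -- c Q is a value of Q', so a common divisor of N₀ and c Q' divides (c Q)².
  N₀⊥c' : Coprime N₀ ∣ c Q' ∣
  N₀⊥c' {d} (d∣N₀ , d∣c') = N₀⊥c (d∣N₀ , d∣c)
    where
    d∣a' : + d ∣ₛ a Q'
    d∣a' = Signed.∣-trans (∣ᵤ⇒∣ {+ d} {+ M} (ℕ.∣-trans d∣N₀ N₀∣M)) M∣a'
    d²∣disc' : + d · + d ∣ₛ disc Q'
    d²∣disc' = subst₂ _∣ₛ_ (pos-* d d) (sym disc'≡D) (Signed.∣-trans
      (∣ᵤ⇒∣ {+ (d * d)} {+ (N₀ ^ 2)} (ℕ.*-pres-∣ d∣N₀ (ℕ.∣-trans d∣N₀ (ℕ.m∣m*n 1)))) N₀²∣D)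
    d∣c² : + d ∣ₛ c Q · c Q
    d∣c² = subst (λ R → + d ∣ₛ c R · c R) (act-adj Q g det-g)
      (∣a∧∣c∧²∣disc⇒∣value² Q' (- β g) (α g) d∣a' (∣ᵤ⇒∣ {+ d} {c Q'} d∣c') d²∣disc')
    d∣c : d ∣ ∣ c Q ∣
    d∣c = Coprime.coprime-divisor (coprime-∣ˡ d∣N₀ N₀⊥c)
            (subst (d ∣_) (abs-* (c Q) (c Q)) (∣⇒∣ᵤ {+ d} {c Q · c Q} d∣c²))

p∣value⇒p∣x : ∀ {p} → Prime p → ∀ Q x y → + p ∣ₛ b Q → + p ∣ₛ c Q → ¬ + p ∣ₛ a Q →
              + p ∣ₛ value Q x y → + p ∣ₛ x
p∣value⇒p∣x pr Q x y p∣b p∣c p∤a p∣value = prime∣i*i⇒∣i pr x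
  (prime∤i⇒∣i*j⇒∣j pr p∤a (subst (_ ∣ₛ_) (ℤ.*-assoc (a Q) x x)
    (Signed.∣m+n∣n⇒∣m (Signed.∣m+n∣n⇒∣m p∣value (Signed.∣m⇒∣m*n y (Signed.∣m⇒∣m*n y p∣c)))
                      (Signed.∣m⇒∣m*n y (Signed.∣m⇒∣m*n x p∣b)))))

scaleA : ℤ → Form → Form
scaleA k Q = [ a Q · k , b Q , c Q ]

scaleC : ℤ → Form → Form
scaleC k Q = [ a Q , b Q , c Q · k ]

scaleA-injective : ∀ k .{{_ : ℤ.NonZero k}} {Q Q'} → scaleA k Q ≡ scaleA k Q' → Q ≡ Q'
scaleA-injective k eq = form-cong (ℤ.*-cancelʳ-≡ _ _ k (cong a eq)) (cong b eq) (cong c eq)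

scaleC-injective : ∀ k .{{_ : ℤ.NonZero k}} {Q Q'} → scaleC k Q ≡ scaleC k Q' → Q ≡ Q'
scaleC-injective k eq = form-cong (cong a eq) (cong b eq) (ℤ.*-cancelʳ-≡ _ _ k (cong c eq))

disc-scaleA : ∀ k Q → disc (scaleA k Q) ≡ disc (scaleC k Q)
disc-scaleA k [ a , b , c ] = poly k a b c
  where
  poly : ∀ k a b c → b · b - (+ 4) · ((a · k) · c) ≡ b · b - (+ 4) · (a · (c · k))
  poly = solve-∀

det-conj : ∀ k x y z w → det (mat x y (z · k) w) ≡ det (mat x (y · k) z w)
det-conj = poly
  where
  poly : ∀ k x y z w → x · w - y · (z · k) ≡ x · w - (y · k) · z
  poly = solve-∀

act-conj : ∀ k Q x y z w →
  scaleC k (act (scaleA k Q) (mat x y (z · k) w)) ≡ scaleA k (act (scaleC k Q) (mat x (y · k) z w))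
act-conj k [ a , b , c ] x y z w = form-cong (polyᵃ k a b c x z) (polyᵇ k a b c x y z w) (polyᶜ k a b c y w)
  where
  polyᵃ : ∀ k a b c x z → (a · k) · x · x + b · x · (z · k) + c · (z · k) · (z · k)
                         ≡ (a · x · x + b · x · z + (c · k) · z · z) · k
  polyᵃ = solve-∀
  polyᵇ : ∀ k a b c x y z w → (+ 2) · (a · k) · x · y + b · (x · w + y · (z · k)) + (+ 2) · c · (z · k) · w
                             ≡ (+ 2) · a · x · (y · k) + b · (x · w + (y · k) · z) + (+ 2) · (c · k) · z · w
  polyᵇ = solve-∀
  polyᶜ : ∀ k a b c y w → ((a · k) · y · y + b · y · w + c · w · w) · k
                         ≡ a · (y · k) · (y · k) + b · (y · k) · w + (c · k) · w · w
  polyᶜ = solve-∀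

τ-scaleA : ∀ p (pr : Prime p) Q → τ p pr (scaleA (+ p) Q) ≡ scaleC (+ p) Q
τ-scaleA p pr Q = cong (λ k → [ k , b Q , c Q · + p ]) (i*n/ℕn≡i (a Q) p {{prime⇒nonZero pr}})

∣a⇒≡scaleA : ∀ {k} Q → k ∣ₛ a Q → ∃ λ Q₀ → Q ≡ scaleA k Q₀
∣a⇒≡scaleA Q (divides q a≡qk) = [ q , b Q , c Q ] , cong (λ t → [ t , b Q , c Q ]) a≡qk

∣c⇒≡scaleC : ∀ {k} Q → k ∣ₛ c Q → ∃ λ Q₀ → Q ≡ scaleC k Q₀
∣c⇒≡scaleC Q (divides q c≡qk) = [ a Q , b Q , q ] , cong (λ t → [ a Q , b Q , t ]) c≡qk

Np∣⇒≡*p : ∀ {N p i} → + (N * p) ∣ₛ i → ∃ λ j → i ≡ j · + p × + N ∣ₛ j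
Np∣⇒≡*p {N} {p} (divides q refl) =
  q · + N , trans (cong (q ·_) (pos-* N p)) (sym (ℤ.*-assoc q (+ N) (+ p))) , Signed.∣n⇒∣m*n q Signed.∣-refl

N∣⇒Np∣*p : ∀ {N p j} → + N ∣ₛ j → + (N * p) ∣ₛ j · + p
N∣⇒Np∣*p {N} {p} N∣j = subst (_∣ₛ _) (sym (pos-* N p)) (Signed.*-monoˡ-∣ (+ p) N∣j)

Np∣*p⇒N∣ : ∀ {N p j} .{{_ : NonZero p}} → + (N * p) ∣ₛ j · + p → + N ∣ₛ j
Np∣*p⇒N∣ {N} {p} Np∣jp = Signed.*-cancelʳ-∣ (+ p) (subst (_∣ₛ _) (pos-* N p) Np∣jp)

scaleA-≈⇒scaleC-≈ : ∀ {N p} .{{_ : NonZero p}} Q Q' →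
  scaleA (+ p) Q ≈[ N * p ] scaleA (+ p) Q' → scaleC (+ p) Q ≈[ N ] scaleC (+ p) Q'
scaleA-≈⇒scaleC-≈ {N} {p} Q Q' (g@(mat x y _ w) , g∈Γ₀@(det-g , _) , eq) with Np∣⇒≡*p {N} (Γ₀-∣γ g g∈Γ₀)
... | z , refl , N∣z =
  mat x (y · + p) z w , Γ₀-intro (mat x (y · + p) z w) (trans (sym (det-conj (+ p) x y z w)) det-g) N∣z ,
  scaleA-injective (+ p) (trans (sym (act-conj (+ p) Q x y z w)) (cong (scaleC (+ p)) eq))

scaleC-act⇒scaleA-≈ : ∀ {N p} .{{_ : NonZero p}} Q Q' h → InΓ₀ N h → + p ∣ₛ β h →
  act (scaleC (+ p) Q) h ≡ scaleC (+ p) Q' → scaleA (+ p) Q ≈[ N * p ] scaleA (+ p) Q'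
scaleC-act⇒scaleA-≈ {N} {p} Q Q' (mat x _ z w) h∈Γ₀@(det-h , _) (divides y refl) eq =
  mat x y (z · + p) w ,
  Γ₀-intro (mat x y (z · + p) w) (trans (det-conj (+ p) x y z w) det-h)
    (N∣⇒Np∣*p (Γ₀-∣γ (mat x (y · + p) z w) h∈Γ₀)) ,
  scaleC-injective (+ p) (trans (act-conj (+ p) Q x y z w) (cong (scaleA (+ p)) eq))

L-scaleA⇒L-scaleC : ∀ {N₀ N p D} .{{_ : NonZero p}} Q → Coprime N₀ p →
  InL N₀ (N * p) D (scaleA (+ p) Q) → InL N₀ N D (scaleC (+ p) Q)
L-scaleA⇒L-scaleC {N = N} {p} Q N₀⊥p (disc≡D , Np∣ap , N₀⊥c) =
  trans (sym (disc-scaleA (+ p) Q)) disc≡D ,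
  ∣⇒∣ᵤ {+ N} {a Q} (Np∣*p⇒N∣ (∣ᵤ⇒∣ {+ (N * p)} {a Q · + p} Np∣ap)) ,
  subst (Coprime _) (sym (abs-* (c Q) (+ p))) (coprime-* N₀⊥c N₀⊥p)

L-scaleC⇒L-scaleA : ∀ {N₀ N p D} Q → InL N₀ N D (scaleC (+ p) Q) → InL N₀ (N * p) D (scaleA (+ p) Q)
L-scaleC⇒L-scaleA {N = N} {p} Q (disc≡D , N∣a , N₀⊥cp) =
  trans (disc-scaleA (+ p) Q) disc≡D ,
  ∣⇒∣ᵤ {+ (N * p)} {a Q · + p} (N∣⇒Np∣*p (∣ᵤ⇒∣ {+ N} {a Q} N∣a)) ,
  coprime-∣ʳ (∣⇒∣ᵤ {c Q} {c Q · + p} (Signed.∣m⇒∣m*n (+ p) Signed.∣-refl)) N₀⊥cp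

bézout⇒≈p∣b : ∀ {M p} R u v → u · ((+ 2) · a R) + v · + p ≡ + 1 →
              ∃ λ R' → R ≈[ M ] R' × a R' ≡ a R × + p ∣ₛ b R'
bézout⇒≈p∣b {M} {p} R u v bézout =
  act R T , (T , Γ₀-intro T (det-T k) (divides (+ 0) refl) , refl) , cong a (act-I₂ R) ,
  divides (b R · v) b'≡bvp
  where
  open ≡-Reasoning
  k = - (b R · u)
  T = mat (+ 1) k (+ 0) (+ 1)
  det-T : ∀ k → + 1 · + 1 - k · + 0 ≡ + 1
  det-T = solve-∀
  poly₁ : ∀ a b c u → (+ 2) · a · + 1 · (- (b · u)) + b · (+ 1 · + 1 + (- (b · u)) · + 0) + (+ 2) · c · + 0 · + 1
                      ≡ b · (+ 1 - u · ((+ 2) · a))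
  poly₁ = solve-∀
  poly₂ : ∀ b t v P → b · (t + v · P - t) ≡ (b · v) · P
  poly₂ = solve-∀
  b'≡bvp : polar R (+ 1) (+ 0) k (+ 1) ≡ (b R · v) · + p
  b'≡bvp = begin
    polar R (+ 1) (+ 0) k (+ 1)                             ≡⟨ poly₁ (a R) (b R) (c R) u ⟩
    b R · (+ 1 - u · ((+ 2) · a R))                         ≡⟨ cong (λ t → b R · (t - u · ((+ 2) · a R))) bézout ⟨
    b R · (u · ((+ 2) · a R) + v · + p - u · ((+ 2) · a R)) ≡⟨ poly₂ (b R) (u · ((+ 2) · a R)) v (+ p) ⟩
    (b R · v) · + p                                         ∎

Γ₀-completion : ∀ {N p} → Coprime N p → ∃ λ g → InΓ₀ N g × α g ≡ + p
Γ₀-completion {N} {p} N⊥p = case bézoutℤ (+ N) p N⊥p of λ (u , v , bézout) →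
  mat (+ p) (- u) (+ N) v ,
    Γ₀-intro (mat (+ p) (- u) (+ N) v) (trans (poly (+ p) u v (+ N)) bézout) Signed.∣-refl , refl
  where
  poly : ∀ P u v N → P · v - (- u) · N ≡ u · N + v · P
  poly = solve-∀

p∣b∧p∣c⇒≈p∣a : ∀ {N p} → Coprime N p → ∀ R → + p ∣ₛ b R → + p ∣ₛ c R →
               ∃ λ R' → R ≈[ N ] R' × + p ∣ₛ a R'
p∣b∧p∣c⇒≈p∣a {N} {p} N⊥p R p∣b p∣c = case Γ₀-completion N⊥p of λ (g , g∈Γ₀ , α≡p) →
  act R g , (g , g∈Γ₀ , refl) ,
    ∣x∧∣b∧∣c⇒∣value R (α g) (γ g) (subst (+ p ∣ₛ_) (sym α≡p) Signed.∣-refl) p∣b p∣c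

p∣a⇒≈p∣c : ∀ {N p} → Coprime N p → ∀ R → + p ∣ₛ a R → ∃ λ R' → R ≈[ N ] R' × + p ∣ₛ c R'
p∣a⇒≈p∣c {N} {p} N⊥p R p∣a = case Γ₀-completion N⊥p of λ (g , g∈Γ₀ , α≡p) →
  act R (adj g) , (adj g , Γ₀-adj g g∈Γ₀ , refl) ,
    ∣a∧∣y⇒∣value R (- β g) (α g) p∣a (subst (+ p ∣ₛ_) (sym α≡p) Signed.∣-refl)

module Ramified {p} (pr : Prime p) (p-odd : ¬ 2 ∣ p) {D} (p∣D : + p ∣ₛ D) (p²∤D : ¬ + (p ^ 2) ∣ₛ D)
  where

  private instance
    p≢0 : NonZero p
    p≢0 = prime⇒nonZero pr


  p∤2 : ¬ + p ∣ₛ + 2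
  p∤2 p∣2 with irreducible[2] (∣⇒∣ᵤ {+ p} {+ 2} p∣2)
  ... | inj₁ refl = ¬prime[1] pr
  ... | inj₂ refl = p-odd ℕ.∣-refl

  p∤4 : ¬ + p ∣ₛ + 4
  p∤4 p∣4 = p∤2 (prime∣i*i⇒∣i pr (+ 2) p∣4)

  p∣a⇒p∣b : ∀ Q → disc Q ≡ D → + p ∣ₛ a Q → + p ∣ₛ b Q
  p∣a⇒p∣b [ a , b , c ] disc≡D p∣a = prime∣i*i⇒∣i pr b (subst (+ p ∣ₛ_) (poly a b c)
    (Signed.∣m∣n⇒∣m+n (subst (+ p ∣ₛ_) (sym disc≡D) p∣D) (Signed.∣n⇒∣m*n (+ 4) (Signed.∣m⇒∣m*n c p∣a))))
    where
    poly : ∀ a b c → b · b - (+ 4) · (a · c) + (+ 4) · (a · c) ≡ b · b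
    poly = solve-∀

  p∣b⇒p∣ac : ∀ Q → disc Q ≡ D → + p ∣ₛ b Q → + p ∣ₛ a Q · c Q
  p∣b⇒p∣ac [ a , b , c ] disc≡D p∣b = prime∤i⇒∣i*j⇒∣j pr p∤4 (subst (+ p ∣ₛ_) (poly a b c)
    (Signed.∣m∣n⇒∣m-n (Signed.∣m⇒∣m*n b p∣b) (subst (+ p ∣ₛ_) (sym disc≡D) p∣D)))
    where
    poly : ∀ a b c → b · b - (b · b - (+ 4) · (a · c)) ≡ (+ 4) · (a · c)
    poly = solve-∀

  p∣a⇒p²∤ac : ∀ Q → disc Q ≡ D → + p ∣ₛ a Q → ¬ + p · + p ∣ₛ a Q · c Q
  p∣a⇒p²∤ac Q@([ a , b , c ]) disc≡D p∣a (divides t ac≡tp²) with p∣a⇒p∣b Q disc≡D p∣a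
  ... | divides s refl = p²∤D (subst (_∣ₛ D) (sym (pos-^2 p)) (divides (s · s - (+ 4) · t) (begin
    D                                               ≡⟨ disc≡D ⟨
    s · + p · (s · + p) - (+ 4) · (a · c)           ≡⟨ cong (λ u → s · + p · (s · + p) - (+ 4) · u) ac≡tp² ⟩
    s · + p · (s · + p) - (+ 4) · (t · (+ p · + p)) ≡⟨ poly s t (+ p) ⟩
    (s · s - (+ 4) · t) · (+ p · + p)               ∎)))
    where
    open ≡-Reasoning
    poly : ∀ s t P → s · P · (s · P) - (+ 4) · (t · (P · P)) ≡ (s · s - (+ 4) · t) · (P · P)
    poly = solve-∀

  p∣a⇒p∤c : ∀ Q → disc Q ≡ D → + p ∣ₛ a Q → ¬ + p ∣ₛ c Q
  p∣a⇒p∤c Q disc≡D p∣a p∣c =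
    p∣a⇒p²∤ac Q disc≡D p∣a (Signed.∣-trans (Signed.*-monoʳ-∣ (+ p) p∣c) (Signed.*-monoˡ-∣ (c Q) p∣a))

  translate-p∣b : ∀ {M} R → ¬ + p ∣ₛ a R → ∃ λ R' → R ≈[ M ] R' × a R' ≡ a R × + p ∣ₛ b R'
  translate-p∣b R p∤a =
    case bézoutℤ ((+ 2) · a R) p (Coprime.sym (prime∤⇒coprime pr p∤2a)) of λ (u , v , bézout) →
    bézout⇒≈p∣b R u v bézout
    where
    p∤2a : ¬ p ∣ ∣ (+ 2) · a R ∣
    p∤2a p∣2a = p∤a (prime∤i⇒∣i*j⇒∣j pr p∤2 (∣ᵤ⇒∣ {+ p} {(+ 2) · a R} p∣2a))

  ≈p∣a : ∀ {N} → Coprime N p → ∀ R → disc R ≡ D → ∃ λ R' → R ≈[ N ] R' × + p ∣ₛ a R'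
  ≈p∣a {N} N⊥p R disc≡D with + p Signed.∣? a R
  ... | yes p∣a = R , ≈-refl , p∣a
  ... | no p∤a = case translate-p∣b {N} R p∤a of λ (R₁ , R≈R₁ , a₁≡a , p∣b₁) →
    let p∤a₁ : ¬ + p ∣ₛ a R₁
        p∤a₁ p∣a₁ = p∤a (subst (+ p ∣ₛ_) a₁≡a p∣a₁)
        p∣c₁ : + p ∣ₛ c R₁
        p∣c₁ = prime∤i⇒∣i*j⇒∣j pr p∤a₁ (p∣b⇒p∣ac R₁ (trans (≈-disc {Q = R} R≈R₁) disc≡D) p∣b₁)
    in case p∣b∧p∣c⇒≈p∣a N⊥p R₁ p∣b₁ p∣c₁ of λ (R₂ , R₁≈R₂ , p∣a₂) →
    R₂ , ≈-trans {Q = R} R≈R₁ R₁≈R₂ , p∣a₂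

  ≈p∣c : ∀ {N} → Coprime N p → ∀ R → disc R ≡ D → ∃ λ R' → R ≈[ N ] R' × + p ∣ₛ c R'
  ≈p∣c N⊥p R disc≡D = case ≈p∣a N⊥p R disc≡D of λ (R₁ , R≈R₁ , p∣a₁) →
    case p∣a⇒≈p∣c N⊥p R₁ p∣a₁ of λ (R₂ , R₁≈R₂ , p∣c₂) →
    R₂ , ≈-trans {Q = R} R≈R₁ R₁≈R₂ , p∣c₂

  p∣a∧p∣a'⇒p∣γ : ∀ Q g → disc Q ≡ D → + p ∣ₛ a Q → + p ∣ₛ a (act Q g) → + p ∣ₛ γ g
  p∣a∧p∣a'⇒p∣γ Q g disc≡D p∣a p∣a' = p∣value⇒p∣x pr [ c Q , b Q , a Q ] (γ g) (α g)
    (p∣a⇒p∣b Q disc≡D p∣a) p∣a (p∣a⇒p∤c Q disc≡D p∣a)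
    (subst (+ p ∣ₛ_) (poly (a Q) (b Q) (c Q) (α g) (γ g)) p∣a')
    where
    poly : ∀ a b c x z → a · x · x + b · x · z + c · z · z ≡ c · z · z + b · z · x + a · x · x
    poly = solve-∀

  p∣c'⇒p∣β : ∀ Q h → disc (scaleA (+ p) Q) ≡ D → + p ∣ₛ c (act (scaleC (+ p) Q) h) → + p ∣ₛ β h
  p∣c'⇒p∣β Q h disc≡D p∣c' =
    p∣value⇒p∣x pr (scaleC (+ p) Q) (β h) (δ h) p∣b (Signed.∣n⇒∣m*n (c Q) Signed.∣-refl) p∤a p∣c'
    where
    p∣ap : + p ∣ₛ a Q · + p
    p∣ap = Signed.∣n⇒∣m*n (a Q) Signed.∣-refl
    p∣b : + p ∣ₛ b Q
    p∣b = p∣a⇒p∣b (scaleA (+ p) Q) disc≡D p∣ap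
    p∤a : ¬ + p ∣ₛ a Q
    p∤a p∣a = p∣a⇒p²∤ac (scaleA (+ p) Q) disc≡D p∣ap (Signed.∣m⇒∣m*n (c Q) (Signed.*-monoˡ-∣ (+ p) p∣a))

  scaleC-≈⇒scaleA-≈ : ∀ {N} Q Q' → disc (scaleA (+ p) Q) ≡ D →
    scaleC (+ p) Q ≈[ N ] scaleC (+ p) Q' → scaleA (+ p) Q ≈[ N * p ] scaleA (+ p) Q'
  scaleC-≈⇒scaleA-≈ Q Q' disc≡D (h , h∈Γ₀ , eq) =
    scaleC-act⇒scaleA-≈ Q Q' h h∈Γ₀ (p∣c'⇒p∣β Q h disc≡D p∣c') eq
    where
    p∣c' : + p ∣ₛ c (act (scaleC (+ p) Q) h)
    p∣c' = subst (λ R → + p ∣ₛ c R) (sym eq) (Signed.∣n⇒∣m*n (c Q') Signed.∣-refl)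

  module _ {N₀ N} (N⊥p : Coprime N p) (N₀∣N : N₀ ∣ N) (N₀²∣D : + (N₀ ^ 2) ∣ₛ D) where

    L-Np⇒L-N : ∀ Q → InL N₀ (N * p) D Q → InL N₀ N D Q
    L-Np⇒L-N _ (disc≡D , Np∣a , N₀⊥c) = disc≡D , ℕ.∣-trans (ℕ.m∣m*n p) Np∣a , N₀⊥c

    L-Np⇒p∣a : ∀ Q → InL N₀ (N * p) D Q → + p ∣ₛ a Q
    L-Np⇒p∣a Q (_ , Np∣a , _) = ∣ᵤ⇒∣ {+ p} {a Q} (ℕ.∣-trans (ℕ.n∣m*n N) Np∣a)

    L-N⇒p∣a⇒L-Np : ∀ Q → InL N₀ N D Q → + p ∣ₛ a Q → InL N₀ (N * p) D Q
    L-N⇒p∣a⇒L-Np Q (disc≡D , N∣a , N₀⊥c) p∣a =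
      disc≡D , coprime-∣⇒*∣ N⊥p N∣a (∣⇒∣ᵤ {+ p} {a Q} p∣a) , N₀⊥c

    Γ₀-N∩p∣γ⇒Γ₀-Np : ∀ g → InΓ₀ N g → + p ∣ₛ γ g → InΓ₀ (N * p) g
    Γ₀-N∩p∣γ⇒Γ₀-Np g (det-g , N∣γ) p∣γ = det-g , coprime-∣⇒*∣ N⊥p N∣γ (∣⇒∣ᵤ {+ p} {γ g} p∣γ)

    id-bijection : InducesBijection N₀ (N * p) N D idMap
    id-bijection = L-Np⇒L-N , (λ Q _ _ _ → ≈-mono {Q = Q} (ℕ.m∣m*n p)) , injective , surjective
      where
      injective : ∀ Q Q' → InL N₀ (N * p) D Q → InL N₀ (N * p) D Q' → Q ≈[ N ] Q' → Q ≈[ N * p ] Q'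
      injective Q Q' LQ LQ' (g , g∈Γ₀ , refl) =
        g , Γ₀-N∩p∣γ⇒Γ₀-Np g g∈Γ₀
              (p∣a∧p∣a'⇒p∣γ Q g (proj₁ LQ) (L-Np⇒p∣a Q LQ) (L-Np⇒p∣a (act Q g) LQ')) , refl
      surjective : ∀ R → InL N₀ N D R → ∃ λ Q → InL N₀ (N * p) D Q × Q ≈[ N ] R
      surjective R LR = case ≈p∣a N⊥p R (proj₁ LR) of λ (R' , R≈R' , p∣a') →
        R' , L-N⇒p∣a⇒L-Np R' (≈-preserves-L {Q = R} N₀∣N N₀²∣D R≈R' LR) p∣a' , ≈-sym {Q = R} R≈R'

    N₀⊥p : Coprime N₀ p
    N₀⊥p = coprime-∣ˡ N₀∣N N⊥p

    L-Np⇒≡scaleA : ∀ Q → InL N₀ (N * p) D Q → ∃ λ Q₀ → Q ≡ scaleA (+ p) Q₀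
    L-Np⇒≡scaleA Q LQ = ∣a⇒≡scaleA Q (L-Np⇒p∣a Q LQ)

    L-N∧p∣c⇒τ-preimage : ∀ R → InL N₀ N D R → + p ∣ₛ c R → ∃ λ Q → InL N₀ (N * p) D Q × τ p pr Q ≡ R
    L-N∧p∣c⇒τ-preimage R LR p∣c with ∣c⇒≡scaleC R p∣c
    ... | Q₀ , refl = scaleA (+ p) Q₀ , L-scaleC⇒L-scaleA Q₀ LR , τ-scaleA p pr Q₀

    τ-bijection : InducesBijection N₀ (N * p) N D (τ p pr)
    τ-bijection = preserves-L , preserves-≈ , injective , surjective
      where
      preserves-L : ∀ Q → InL N₀ (N * p) D Q → InL N₀ N D (τ p pr Q)
      preserves-L Q LQ with L-Np⇒≡scaleA Q LQ
      ... | Q₀ , refl = subst (InL N₀ N D) (sym (τ-scaleA p pr Q₀)) (L-scaleA⇒L-scaleC Q₀ N₀⊥p LQ)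
      preserves-≈ : ∀ Q Q' → InL N₀ (N * p) D Q → InL N₀ (N * p) D Q' →
                    Q ≈[ N * p ] Q' → τ p pr Q ≈[ N ] τ p pr Q'
      preserves-≈ Q Q' LQ LQ' Q≈Q' with L-Np⇒≡scaleA Q LQ | L-Np⇒≡scaleA Q' LQ'
      ... | Q₀ , refl | Q₀' , refl = subst₂ _≈[ N ]_ (sym (τ-scaleA p pr Q₀)) (sym (τ-scaleA p pr Q₀'))
                                       (scaleA-≈⇒scaleC-≈ Q₀ Q₀' Q≈Q')
      injective : ∀ Q Q' → InL N₀ (N * p) D Q → InL N₀ (N * p) D Q' →
                  τ p pr Q ≈[ N ] τ p pr Q' → Q ≈[ N * p ] Q'
      injective Q Q' LQ LQ' τQ≈τQ' with L-Np⇒≡scaleA Q LQ | L-Np⇒≡scaleA Q' LQ'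
      ... | Q₀ , refl | Q₀' , refl = scaleC-≈⇒scaleA-≈ Q₀ Q₀' (proj₁ LQ)
              (subst₂ _≈[ N ]_ (τ-scaleA p pr Q₀) (τ-scaleA p pr Q₀') τQ≈τQ')
      surjective : ∀ R → InL N₀ N D R → ∃ λ Q → InL N₀ (N * p) D Q × τ p pr Q ≈[ N ] R
      surjective R LR = case ≈p∣c N⊥p R (proj₁ LR) of λ (R' , R≈R' , p∣c') →
        let LR' = ≈-preserves-L {Q = R} N₀∣N N₀²∣D R≈R' LR in
        case L-N∧p∣c⇒τ-preimage R' LR' p∣c' of λ (Q , LQ , τQ≡R') →
        Q , LQ , subst (_≈[ N ] R) (sym τQ≡R') (≈-sym {Q = R} R≈R')

corollary3p4 : (N N₀ N₁ p : ℕ) (Δ : ℤ) →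
    1 ≤ N → ¬ (2 ∣ N) → N ≡ N₀ * N₁ → 1 ≤ N₀ → 1 ≤ N₁ → Coprime N₀ N₁ →
    (pr : Prime p) → ¬ (2 ∣ p) → ¬ (p ∣ N) →
    IsDiscriminant Δ → (+ p) ℤ.∣ Δ → ¬ ((+ (p ^ 2)) ℤ.∣ Δ) →
    InducesBijection N₀ (N * p) N ((+ (N₀ ^ 2)) ℤ.* Δ) idMap
      × InducesBijection N₀ (N * p) N ((+ (N₀ ^ 2)) ℤ.* Δ) (τ p pr)
corollary3p4 N N₀ N₁ p Δ _ _ N≡N₀N₁ _ _ _ pr p-odd p∤N _ p∣Δ p²∤Δ =
  id-bijection N⊥p N₀∣N N₀²∣D , τ-bijection N⊥p N₀∣N N₀²∣D
  where
  N₀∣N : N₀ ∣ N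
  N₀∣N = ℕ.divides N₁ (trans N≡N₀N₁ (ℕ.*-comm N₀ N₁))
  N⊥p : Coprime N p
  N⊥p = Coprime.sym (prime∤⇒coprime pr p∤N)
  p⊥N₀ : Coprime p N₀
  p⊥N₀ = prime∤⇒coprime pr (λ p∣N₀ → p∤N (ℕ.∣-trans p∣N₀ N₀∣N))
  N₀²∣D : + (N₀ ^ 2) ∣ₛ + (N₀ ^ 2) · Δ
  N₀²∣D = Signed.∣m⇒∣m*n Δ Signed.∣-refl
  p∣D : + p ∣ₛ + (N₀ ^ 2) · Δ
  p∣D = Signed.∣n⇒∣m*n (+ (N₀ ^ 2)) (∣ᵤ⇒∣ p∣Δ)
  p²∤D : ¬ + (p ^ 2) ∣ₛ + (N₀ ^ 2) · Δ
  p²∤D p²∣D = p²∤Δ (ℤCoprime.coprime-divisor (+ (p ^ 2)) (+ (N₀ ^ 2)) Δ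
    (Coprime.sym (coprime-^2 (Coprime.sym (coprime-^2 p⊥N₀)))) (∣⇒∣ᵤ p²∣D))
  open Ramified pr p-odd p∣D p²∤D
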